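{- Let $s,t$ be step sequences over a g-comtrace alphabet $(E,sim,ser,inl)$ such that $\lhd_s\in ext(G^{\{t\}})$. Then $G^{\{s\}}=G^{\{t\}}$.
   Context: Relations: for $R$ on $X$, $R^{ -1}$ inverse, $R^*=\bigcup_{i\ge0}R^i$ ($R^0=\mathrm{id}_X$), $R\circ S=\{(x,y):\exists z.\,xRz\wedge zSy\}$, $R^{\mathrm{sym}}=R\cup R^{ -1}$, $R^{\Cap}=R\cap R^{ -1}$, $R^C=(X\times X)\setminus R$. A g-comtrace alphabet is $(E,sim,ser,inl)$ with $E$ finite, $sim,inl\subseteq E\times E$ irreflexive and symmetric, $ser\subseteq sim$, $sim\cap inl=\emptyset$. Steps $\mathbb{S}$: nonempty $A\subseteq E$ with $(a,b)\in sim$ for all distinct $a,b\in A$; step sequences: elements of $\mathbb{S}^*$. For $s=A_1\dots A_k$: $\overline{A_i}=\{e^{(m+1)}:e\in A_i\}$ where $m$ is the number of $j<i$ with $e\in A_j$; $\Sigma_s=\bigcup_i\overline{A_i}$; $l(e^{(j)})=e$; $pos_s(\alpha)=i$ iff $\alpha\in\overline{A_i}$; $\alpha\lhd_s\beta$ iff $pos_s(\alpha)<pos_s(\beta)$; $\alpha\lhd_s^\frown\beta$ iff $\alpha\ne\beta\wedge pos_s(\alpha)\le pos_s(\beta)$. Closures: $(X,R_1,R_2)^\lozenge=(X,\prec_{R_1,R_2},\sqsubset_{R_1,R_2})$ with $\prec_{R_1,R_2}=(R_1\cup R_2)^*\circ R_1\circ(R_1\cup R_2)^*$, $\sqsubset_{R_1,R_2}=(R_1\cup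 R_2)^*\setminus\mathrm{id}_X$; for $R_3=R_1\cap R_2^*$, $(X,R_1,R_2)^{\bowtie}=(X,(\prec_{R_3,R_2})^{\mathrm{sym}}\cup R_1,\sqsubset_{R_3,R_2})$. On $\Sigma_s$: $\alpha<\!\!>_s\beta$ iff $(l(\alpha),l(\beta))\in inl$; $\alpha\sqsubset_s\beta$ iff $\alpha\lhd_s^\frown\beta$ and $(l(\beta),l(\alpha))\notin ser\cup inl$; $\alpha\prec_s\beta$ iff $\alpha\lhd_s\beta$ and one of: (i) $(l(\alpha),l(\beta))\notin ser\cup inl$; (ii) $(\alpha,\beta)\in<\!\!>_s\cap((\sqsubset_s^*)^{\Cap}\circ(<\!\!>_s)^C\circ(\sqsubset_s^*)^{\Cap})$; (iii) $(l(\alpha),l(\beta))\in ser$ and there are $\delta,\gamma\in\Sigma_s$ with $\delta\lhd_s\gamma$, $(l(\delta),l(\gamma))\notin ser$, $\alpha\sqsubset_s^*\delta\sqsubset_s^*\beta$, $\alpha\sqsubset_s^*\gamma\sqsubset_s^*\beta$. $G^{\{s\}}=(\Sigma_s,\prec_s\cup<\!\!>_s,\prec_s\cup\sqsubset_s)^{\bowtie}$. A stratified order on $X$ is an irreflexive transitive $\lhd$ for which $a\simeq b\iff(a=b\vee(\neg a\lhd b\wedge\neg b\lhd a))$ is an equivalence; $\alpha\lhd^\frown\beta$ iff $\alpha\ne\beta\wedge\neg(\beta\lhd\alpha)$. For $G=(X,<\!\!>,\sqsubset)$, $ext(G)$ is the set of stratified orders $\lhd$ on $X$ with $\alpha<\!\!>\beta\Rightarrow(\alpha\lhd\beta\vee\beta\lhd\alpha)$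 and $\alpha\sqsubset\beta\Rightarrow\alpha\lhd^\frown\beta$. -}

module Defs where

open import Data.Nat using (ℕ; zero; suc; _<_; _≤_)
open import Data.Fin using (Fin)
open import Data.Bool using (Bool; true; false; T; _∨_; if_then_else_)
open import Data.Vec using (lookup)
open import Data.Fin.Subset using (Subset; _∈_; Nonempty)
open import Data.List using (List; []; _∷_)
open import Data.List.Relation.Unary.All using (All)
open import Data.Product using (Σ; _×_; _,_; ∃; proj₁)
open import Data.Sum using (_⊎_)
open import Relation.Nullary using (¬_)
open import Relation.Binary.PropositionalEquality using (_≡_; _≢_)

-- g-comtrace alphabets.  E = Fin n (finite); relations are Bool-valued
-- (every relation on a finite set is decidable classically).

record GComtraceAlphabet : Set where
  field
    n   : ℕ
    sim : Fin n → Fin n → Bool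
    ser : Fin n → Fin n → Bool
    inl : Fin n → Fin n → Bool
    sim-irrefl : ∀ a → sim a a ≡ false
    inl-irrefl : ∀ a → inl a a ≡ false
    sim-sym    : ∀ a b → sim a b ≡ sim b a
    inl-sym    : ∀ a b → inl a b ≡ inl b a
    ser⊆sim    : ∀ a b → T (ser a b) → T (sim a b)
    sim∩inl≡∅  : ∀ a b → T (sim a b) → ¬ T (inl a b)

module _ (Γ : GComtraceAlphabet) where
  open GComtraceAlphabet Γ

  E : Set
  E = Fin n

  IsStep : Subset n → Set
  IsStep A = Nonempty A × (∀ a b → a ≢ b → a ∈ A → b ∈ A → T (sim a b))

  Step : Set
  Step = Σ (Subset n) IsStep

  StepSeq : Set
  StepSeq = List Step

  -- Universe of (potential) event occurrences: (e , j) stands for e^(j+1).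
  Occ : Set
  Occ = E × ℕ

  l : Occ → E
  l = proj₁

  Pred : Set₁
  Pred = Occ → Set

  Rel : Set₁
  Rel = Occ → Occ → Set

  count : StepSeq → E → ℕ
  count [] e = 0
  count ((A , _) ∷ s) e = if lookup A e then suc (count s e) else count s e

  Σₛ : StepSeq → Pred
  Σₛ s (e , j) = j < count s e

  -- pos_s (0-based index of the step containing e^(j+1); only compared)
  pos : StepSeq → Occ → ℕ
  pos [] _ = 0
  pos ((A , _) ∷ s) (e , j) with lookup A e | j
  ... | true  | zero   = 0
  ... | true  | suc j' = suc (pos s (e , j'))
  ... | false | _      = suc (pos s (e , j))

  ◁ : StepSeq → Rel
  ◁ s α β = Σₛ s α × Σₛ s β × pos s α < pos s β

  ◁⌢ : StepSeq → Rel
  ◁⌢ s α β = Σₛ s α × Σₛ s β × α ≢ β × pos s α ≤ pos s β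

  _∪ᵣ_ : Rel → Rel → Rel
  (R ∪ᵣ S) α β = R α β ⊎ S α β

  _∩ᵣ_ : Rel → Rel → Rel
  (R ∩ᵣ S) α β = R α β × S α β

  _⁻¹ : Rel → Rel
  (R ⁻¹) α β = R β α

  _ˢʸᵐ : Rel → Rel
  R ˢʸᵐ = R ∪ᵣ (R ⁻¹)

  _⋒ : Rel → Rel
  R ⋒ = R ∩ᵣ (R ⁻¹)

  _∘ᵣ_ : Rel → Rel → Rel
  (R ∘ᵣ S) α β = ∃ λ γ → R α γ × S γ β

  Compl : Pred → Rel → Rel
  Compl X R α β = X α × X β × ¬ R α β

  data Star (X : Pred) (R : Rel) : Rel where
    ε   : ∀ {α} → X α → Star X R α α
    _◅_ : ∀ {α β γ} → R α β → Star X R β γ → Star X R α γ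

  _∖id : Rel → Rel
  (R ∖id) α β = R α β × α ≢ β

  record RelStr : Set₁ where
    constructor ⟨_,_,_⟩
    field
      carrier : Pred
      rel₁    : Rel
      rel₂    : Rel

  ≺[_,_,_] : Pred → Rel → Rel → Rel
  ≺[ X , R₁ , R₂ ] = Star X (R₁ ∪ᵣ R₂) ∘ᵣ (R₁ ∘ᵣ Star X (R₁ ∪ᵣ R₂))

  ⊏[_,_,_] : Pred → Rel → Rel → Rel
  ⊏[ X , R₁ , R₂ ] = Star X (R₁ ∪ᵣ R₂) ∖id

  ◇ : RelStr → RelStr
  ◇ ⟨ X , R₁ , R₂ ⟩ = ⟨ X , ≺[ X , R₁ , R₂ ] , ⊏[ X , R₁ , R₂ ] ⟩

  ⋈ : RelStr → RelStr
  ⋈ ⟨ X , R₁ , R₂ ⟩ =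
    ⟨ X , (≺[ X , R₃ , R₂ ] ˢʸᵐ) ∪ᵣ R₁ , ⊏[ X , R₃ , R₂ ] ⟩
    where
      R₃ : Rel
      R₃ = R₁ ∩ᵣ Star X R₂

  serinl : E → E → Bool
  serinl a b = ser a b ∨ inl a b

  ⟨⟩ : StepSeq → Rel
  ⟨⟩ s α β = Σₛ s α × Σₛ s β × T (inl (l α) (l β))

  ⊏ : StepSeq → Rel
  ⊏ s α β = ◁⌢ s α β × ¬ T (serinl (l β) (l α))

  ⊏* : StepSeq → Rel
  ⊏* s = Star (Σₛ s) (⊏ s)

  ≺ : StepSeq → Rel
  ≺ s α β =
    ◁ s α β ×
    ( ¬ T (serinl (l α) (l β))
    ⊎ ( ⟨⟩ s α β ×
        (((⊏* s) ⋒) ∘ᵣ (Compl (Σₛ s) (⟨⟩ s) ∘ᵣ ((⊏* s) ⋒))) α β )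
    ⊎ ( T (ser (l α) (l β)) ×
        ∃ λ δ → ∃ λ γ → ◁ s δ γ × ¬ T (ser (l δ) (l γ)) ×
          ⊏* s α δ × ⊏* s δ β × ⊏* s α γ × ⊏* s γ β ) )

  G : StepSeq → RelStr
  G s = ⋈ ⟨ Σₛ s , ≺ s ∪ᵣ ⟨⟩ s , ≺ s ∪ᵣ ⊏ s ⟩

  record StratifiedOrder (X : Pred) (R : Rel) : Set where
    field
      onX     : ∀ α β → R α β → X α × X β
      irrefl  : ∀ α → X α → ¬ R α α
      trans   : ∀ α β γ → X α → X β → X γ → R α β → R β γ → R α γ
      -- a ≃ b ⟺ a = b ∨ (¬ a ◁ b ∧ ¬ b ◁ a) is an equivalence on X;
      -- reflexivity and symmetry are automatic, transitivity is:
      ≃-trans : ∀ α β γ → X α → X β → X γ →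
                (α ≡ β ⊎ (¬ R α β × ¬ R β α)) →
                (β ≡ γ ⊎ (¬ R β γ × ¬ R γ β)) →
                (α ≡ γ ⊎ (¬ R α γ × ¬ R γ α))

  _⌢ : Rel → Rel
  (R ⌢) α β = α ≢ β × ¬ R β α

  record InExt (R : Rel) (𝔾 : RelStr) : Set where
    open RelStr 𝔾
    field
      strat : StratifiedOrder carrier R
      <>⇒   : ∀ α β → rel₁ α β → R α β ⊎ R β α
      ⊏⇒    : ∀ α β → rel₂ α β → (R ⌢) α β

  _≈Pred_ : Pred → Pred → Set
  P ≈Pred Q = ∀ α → (P α → Q α) × (Q α → P α)

  _≈Rel_ : Rel → Rel → Set
  R ≈Rel S = ∀ α β → (R α β → S α β) × (S α β → R α β)

  _≈Str_ : RelStr → RelStr → Set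
  𝔾 ≈Str ℍ = (RelStr.carrier 𝔾 ≈Pred RelStr.carrier ℍ)
           × (RelStr.rel₁ 𝔾 ≈Rel RelStr.rel₁ ℍ)
           × (RelStr.rel₂ 𝔾 ≈Rel RelStr.rel₂ ℍ)

module Submission where

-- Both structures are ⋈-closures of (Σ, ≺ ∪ ⟨⟩, ≺ ∪ ⊏) and ⋈ is monotone in
-- all three components, so with Σₛ = Σₜ (hence ⟨⟩ₛ = ⟨⟩ₜ) it suffices to show
-- ⊏ₛ = ⊏ₜ and ≺ₛ = ≺ₜ.  The extension hypothesis yields: ≺ₜ ⊆ ◁ₛ, ⊏ₜ-pairs are
-- never ◁ₛ-reversed, and ⟨⟩ₜ-pairs are ◁ₛ-comparable.
--  * ⊏ₜ ⊆ ⊏ₛ directly; a ⊏ₛ-pair strictly reversed in t would be a ≺ₜ-pair of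
--    kind (i), hence ◁ₛ-reversed.  So ⊏ and ⊏* agree, and condition (ii) too.
--  * ≺ₜ ⊆ ≺ₛ: the order comes from ≺ₜ ⊆ ◁ₛ; a witness pair of (iii) is
--    ◁ₛ-ordered in one direction, and may be swapped when its labels are in inl.
--  * ≺ₛ ⊆ ≺ₜ: the point is that α ≺ₛ β forces posₜ α < posₜ β.  Occurrences in
--    one step of t have labels in sim, hence not in inl; with this each of the
--    conditions (i)-(iii) rules out posₜ β ≤ posₜ α.

open import Defs
open import Data.Nat using (ℕ; zero; suc; _<_; _≤_; s≤s)
open import Data.Nat.Properties
  using (<-irrefl; ≤-refl; ≤-trans; <-asym; ≮⇒≥; <⇒≱; ≰⇒>; ≤∧≢⇒<; _<?_; suc-injective)
open import Data.Bool using (true; false; T)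
open import Data.Unit using (tt)
open import Data.Vec using (lookup)
open import Data.Vec.Properties using (lookup⇒[]=)
open import Data.List using (_∷_)
open import Data.Product using (_×_; _,_; ∃; proj₁; proj₂; map₂)
open import Data.Fin.Subset using (Subset)
open import Data.Sum as Sum using (_⊎_; inj₁; inj₂)
open import Data.Empty using (⊥-elim)
open import Relation.Nullary using (¬_; yes; no)
open import Relation.Nullary.Decidable using (T?)
open import Relation.Binary.PropositionalEquality
  using (_≡_; _≢_; refl; sym; trans; cong; cong₂; subst; ≢-sym)

module Alphabet (Γ : GComtraceAlphabet) where
  open GComtraceAlphabet Γ

  _⊆ₚ_ : Pred Γ → Pred Γ → Set
  P ⊆ₚ Q = ∀ {α} → P α → Q α

  _⊆ᵣ_ : Rel Γ → Rel Γ → Set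
  R ⊆ᵣ S = ∀ {α β} → R α β → S α β

  neither-ser-nor-inl : ∀ a b → ¬ T (ser a b) → ¬ T (inl a b) → ¬ T (serinl Γ a b)
  neither-ser-nor-inl a b ¬ser ¬inl with ser a b
  ... | true  = ⊥-elim (¬ser tt)
  ... | false = ¬inl

  inl⇒¬ser : ∀ a b → T (inl a b) → ¬ T (ser b a)
  inl⇒¬ser a b i ba = sim∩inl≡∅ b a (ser⊆sim b a ba) (subst T (inl-sym a b) i)

  Star-map : ∀ {X X' R R'} → X ⊆ₚ X' → R ⊆ᵣ R' → Star Γ X R ⊆ᵣ Star Γ X' R'
  Star-map X⊆ R⊆ (ε x)   = ε (X⊆ x)
  Star-map X⊆ R⊆ (r ◅ p) = R⊆ r ◅ Star-map X⊆ R⊆ p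

  module ⋈-Monotone {X X' : Pred Γ} {R₁ R₁' R₂ R₂' : Rel Γ}
                    (X⊆ : X ⊆ₚ X') (R₁⊆ : R₁ ⊆ᵣ R₁') (R₂⊆ : R₂ ⊆ᵣ R₂') where
    generators : _∪ᵣ_ Γ (_∩ᵣ_ Γ R₁ (Star Γ X R₂)) R₂
              ⊆ᵣ _∪ᵣ_ Γ (_∩ᵣ_ Γ R₁' (Star Γ X' R₂')) R₂'
    generators (inj₁ (r , p)) = inj₁ (R₁⊆ r , Star-map X⊆ R₂⊆ p)
    generators (inj₂ r)       = inj₂ (R₂⊆ r)

    ≺-mono : ≺[_,_,_] Γ X (_∩ᵣ_ Γ R₁ (Star Γ X R₂)) R₂
          ⊆ᵣ ≺[_,_,_] Γ X' (_∩ᵣ_ Γ R₁' (Star Γ X' R₂')) R₂'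
    ≺-mono (γ , p , δ , (r , q) , p') =
      γ , Star-map X⊆ generators p , δ , (R₁⊆ r , Star-map X⊆ R₂⊆ q) ,
      Star-map X⊆ generators p'

    rel₁-mono : RelStr.rel₁ (⋈ Γ ⟨ X , R₁ , R₂ ⟩) ⊆ᵣ RelStr.rel₁ (⋈ Γ ⟨ X' , R₁' , R₂' ⟩)
    rel₁-mono (inj₁ (inj₁ p)) = inj₁ (inj₁ (≺-mono p))
    rel₁-mono (inj₁ (inj₂ p)) = inj₁ (inj₂ (≺-mono p))
    rel₁-mono (inj₂ r)        = inj₂ (R₁⊆ r)

    rel₂-mono : RelStr.rel₂ (⋈ Γ ⟨ X , R₁ , R₂ ⟩) ⊆ᵣ RelStr.rel₂ (⋈ Γ ⟨ X' , R₁' , R₂' ⟩)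
    rel₂-mono (p , α≢β) = Star-map X⊆ generators p , α≢β

  ⋈-cong : ∀ {X X' R₁ R₁' R₂ R₂'} → _≈Pred_ Γ X X' →
           R₁ ⊆ᵣ R₁' → R₁' ⊆ᵣ R₁ → R₂ ⊆ᵣ R₂' → R₂' ⊆ᵣ R₂ →
           _≈Str_ Γ (⋈ Γ ⟨ X , R₁ , R₂ ⟩) (⋈ Γ ⟨ X' , R₁' , R₂' ⟩)
  ⋈-cong X≈X' R₁⊆ R₁⊇ R₂⊆ R₂⊇ =
    X≈X' ,
    (λ α β → There.rel₁-mono , Back.rel₁-mono) ,
    (λ α β → There.rel₂-mono , Back.rel₂-mono)
    where
      module There = ⋈-Monotone (λ {α} → proj₁ (X≈X' α)) R₁⊆ R₂⊆
      module Back  = ⋈-Monotone (λ {α} → proj₂ (X≈X' α)) R₁⊇ R₂⊇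

  pos-<⇒≢ : ∀ u {α β} → pos Γ u α < pos Γ u β → α ≢ β
  pos-<⇒≢ u lt α≡β = <-irrefl (cong (pos Γ u) α≡β) lt

  member≢nonmember : ∀ (A : Subset n) {a b} → lookup A a ≡ true → lookup A b ≡ false → a ≢ b
  member≢nonmember A a∈A b∉A refl with trans (sym a∈A) b∉A
  ... | ()

  -- distinct occurrences at the same position lie in one step, so their
  -- labels are simultaneous; induction on u, peeling off the first step
  same-position⇒sim : ∀ u {α β} → Σₛ Γ u α → Σₛ Γ u β → α ≢ β →
                      pos Γ u α ≡ pos Γ u β → T (sim (l Γ α) (l Γ β))
  same-position⇒sim ((A , _ , inStep) ∷ u) {a , i} {b , j} i<#a j<#b α≢β eq
    with lookup A a in a∈A | lookup A b in b∈A
  same-position⇒sim ((A , _ , inStep) ∷ u) {a , zero} {b , zero} _ _ α≢β eq | true | true =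
    inStep a b (λ a≡b → α≢β (cong₂ _,_ a≡b refl)) (lookup⇒[]= a A a∈A) (lookup⇒[]= b A b∈A)
  same-position⇒sim (_ ∷ u) {a , zero} {b , suc j} _ _ _ () | true | true
  same-position⇒sim (_ ∷ u) {a , suc i} {b , zero} _ _ _ () | true | true
  same-position⇒sim (_ ∷ u) {a , suc i} {b , suc j} (s≤s i<#a) (s≤s j<#b) α≢β eq | true | true =
    same-position⇒sim u i<#a j<#b (λ e → α≢β (cong (map₂ suc) e)) (suc-injective eq)
  same-position⇒sim (_ ∷ u) {a , zero} {b , j} _ _ _ () | true | false
  same-position⇒sim ((A , _) ∷ u) {a , suc i} {b , j} (s≤s i<#a) j<#b _ eq | true | false =
    same-position⇒sim u i<#a j<#b (λ e → member≢nonmember A a∈A b∈A (cong proj₁ e))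
      (suc-injective eq)
  same-position⇒sim (_ ∷ u) {a , i} {b , zero} _ _ _ () | false | true
  same-position⇒sim ((A , _) ∷ u) {a , i} {b , suc j} i<#a (s≤s j<#b) _ eq | false | true =
    same-position⇒sim u i<#a j<#b (λ e → member≢nonmember A b∈A a∈A (sym (cong proj₁ e)))
      (suc-injective eq)
  same-position⇒sim (_ ∷ u) i<#a j<#b α≢β eq | false | false =
    same-position⇒sim u i<#a j<#b α≢β (suc-injective eq)

  same-position⇒¬inl : ∀ u {α β} → Σₛ Γ u α → Σₛ Γ u β → α ≢ β →
                       pos Γ u α ≡ pos Γ u β → ¬ T (inl (l Γ α) (l Γ β))
  same-position⇒¬inl u α∈ β∈ α≢β eq =
    sim∩inl≡∅ _ _ (same-position⇒sim u α∈ β∈ α≢β eq)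

  pos-mono-⊏* : ∀ u {α β} → ⊏* Γ u α β → pos Γ u α ≤ pos Γ u β
  pos-mono-⊏* u (ε _)                        = ≤-refl
  pos-mono-⊏* u (((_ , _ , _ , α≤γ) , _) ◅ p) = ≤-trans α≤γ (pos-mono-⊏* u p)

  ⟨⟩-transfer : ∀ u v → Σₛ Γ u ⊆ₚ Σₛ Γ v → ⟨⟩ Γ u ⊆ᵣ ⟨⟩ Γ v
  ⟨⟩-transfer _ _ u⊆v (α∈ , β∈ , i) = u⊆v α∈ , u⊆v β∈ , i

  ⟨⟩-sym : ∀ u {α β} → ⟨⟩ Γ u α β → ⟨⟩ Γ u β α
  ⟨⟩-sym u {α} {β} (α∈ , β∈ , i) = β∈ , α∈ , subst T (inl-sym (l Γ α) (l Γ β)) i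

  CondII : StepSeq Γ → Rel Γ
  CondII u = _∘ᵣ_ Γ (_⋒ Γ (⊏* Γ u)) (_∘ᵣ_ Γ (Compl Γ (Σₛ Γ u) (⟨⟩ Γ u)) (_⋒ Γ (⊏* Γ u)))

  CondII-sym : ∀ u {α β} → CondII u α β → CondII u β α
  CondII-sym u (γ , (αγ , γα) , δ , (γ∈ , δ∈ , ¬γδ) , (δβ , βδ)) =
    δ , (βδ , δβ) , γ , (δ∈ , γ∈ , λ δγ → ¬γδ (⟨⟩-sym u δγ)) , (γα , αγ)

  CondII-transfer : ∀ u v → Σₛ Γ u ⊆ₚ Σₛ Γ v → Σₛ Γ v ⊆ₚ Σₛ Γ u → ⊏ Γ u ⊆ᵣ ⊏ Γ v →
                    CondII u ⊆ᵣ CondII v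
  CondII-transfer u v u⊆v v⊆u ⊏⊆ (γ , (αγ , γα) , δ , (γ∈ , δ∈ , ¬γδ) , (δβ , βδ)) =
    γ , (chain αγ , chain γα) , δ , (u⊆v γ∈ , u⊆v δ∈ , λ γδ → ¬γδ (⟨⟩-transfer v u v⊆u γδ)) ,
    (chain δβ , chain βδ)
    where
      chain : ⊏* Γ u ⊆ᵣ ⊏* Γ v
      chain = Star-map u⊆v ⊏⊆

  Between : StepSeq Γ → Occ Γ → Occ Γ → Occ Γ → Occ Γ → Set
  Between u α β δ γ = ⊏* Γ u α δ × ⊏* Γ u δ β × ⊏* Γ u α γ × ⊏* Γ u γ β

  Between-transfer : ∀ u v {α β δ γ} → Σₛ Γ u ⊆ₚ Σₛ Γ v → ⊏ Γ u ⊆ᵣ ⊏ Γ v →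
                     Between u α β δ γ → Between v α β δ γ
  Between-transfer u v u⊆v ⊏⊆ (αδ , δβ , αγ , γβ) = chain αδ , chain δβ , chain αγ , chain γβ
    where
      chain : ⊏* Γ u ⊆ᵣ ⊏* Γ v
      chain = Star-map u⊆v ⊏⊆

  CondIII : StepSeq Γ → Rel Γ
  CondIII u α β = ∃ λ δ → ∃ λ γ → ◁ Γ u δ γ × ¬ T (ser (l Γ δ) (l Γ γ)) × Between u α β δ γ

  CondIII-swap : ∀ u {α β δ γ} → ◁ Γ u γ δ → T (inl (l Γ δ) (l Γ γ)) →
                 Between u α β δ γ → CondIII u α β
  CondIII-swap u {δ = δ} {γ} γ◁δ i (αδ , δβ , αγ , γβ) =
    γ , δ , γ◁δ , inl⇒¬ser (l Γ δ) (l Γ γ) i , αγ , γβ , αδ , δβ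

module Extension (Γ : GComtraceAlphabet) (s t : StepSeq Γ)
                 (Σₛ≈Σₜ : _≈Pred_ Γ (Σₛ Γ s) (Σₛ Γ t))
                 (◁ₛ∈ext : InExt Γ (◁ Γ s) (G Γ t)) where
  open GComtraceAlphabet Γ
  open Alphabet Γ
  open InExt ◁ₛ∈ext using (<>⇒; ⊏⇒)

  s⇒t : Σₛ Γ s ⊆ₚ Σₛ Γ t
  s⇒t {α} = proj₁ (Σₛ≈Σₜ α)

  t⇒s : Σₛ Γ t ⊆ₚ Σₛ Γ s
  t⇒s {α} = proj₂ (Σₛ≈Σₜ α)

  pt : Occ Γ → ℕ
  pt = pos Γ t

  -- consequences of ◁ₛ ∈ ext(G^{t}): the generators ≺ₜ, ⟨⟩ₜ of the first
  -- relation of G^{t} are ◁ₛ-comparable, and single ≺ₜ- or ⊏ₜ-steps (which lie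
  -- in its second relation) are never ◁ₛ-reversed
  ⟨⟩ₜ-comparable : ∀ {α β} → ⟨⟩ Γ t α β → ◁ Γ s α β ⊎ ◁ Γ s β α
  ⟨⟩ₜ-comparable p = <>⇒ _ _ (inj₂ (inj₂ p))

  ⊏ₜ-not-reversed : ∀ {α β} → ⊏ Γ t α β → ¬ ◁ Γ s β α
  ⊏ₜ-not-reversed p@((_ , β∈ , α≢β , _) , _) = proj₂ (⊏⇒ _ _ (inj₂ (inj₂ p) ◅ ε β∈ , α≢β))

  ≺ₜ⊆◁ₛ : ≺ Γ t ⊆ᵣ ◁ Γ s
  ≺ₜ⊆◁ₛ p@((_ , β∈ , α<β) , _) with <>⇒ _ _ (inj₂ (inj₁ p))
  ... | inj₁ α◁β = α◁β
  ... | inj₂ β◁α =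
    ⊥-elim (proj₂ (⊏⇒ _ _ (inj₂ (inj₁ p) ◅ ε β∈ , pos-<⇒≢ t α<β)) β◁α)

  -- ⊏ₛ = ⊏ₜ: a ⊏ₛ-pair strictly reversed in t would be a ≺ₜ-pair by (i)
  ⊏ₜ⊆⊏ₛ : ⊏ Γ t ⊆ᵣ ⊏ Γ s
  ⊏ₜ⊆⊏ₛ p@((α∈ , β∈ , α≢β , _) , ¬serinl) =
    (t⇒s α∈ , t⇒s β∈ , α≢β , ≮⇒≥ (λ β<α → ⊏ₜ-not-reversed p (t⇒s β∈ , t⇒s α∈ , β<α))) ,
    ¬serinl

  ⊏ₛ⊆⊏ₜ : ⊏ Γ s ⊆ᵣ ⊏ Γ t
  ⊏ₛ⊆⊏ₜ {α} {β} ((α∈ , β∈ , α≢β , α≤β) , ¬serinl) =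
    (s⇒t α∈ , s⇒t β∈ , α≢β , ≮⇒≥ reversed-in-t) , ¬serinl
    where
      reversed-in-t : ¬ pt β < pt α
      reversed-in-t β<α =
        <⇒≱ (proj₂ (proj₂ (≺ₜ⊆◁ₛ ((s⇒t β∈ , s⇒t α∈ , β<α) , inj₁ ¬serinl)))) α≤β

  ⟨⟩ₛ⊆⟨⟩ₜ : ⟨⟩ Γ s ⊆ᵣ ⟨⟩ Γ t
  ⟨⟩ₛ⊆⟨⟩ₜ = ⟨⟩-transfer s t s⇒t

  ⟨⟩ₜ⊆⟨⟩ₛ : ⟨⟩ Γ t ⊆ᵣ ⟨⟩ Γ s
  ⟨⟩ₜ⊆⟨⟩ₛ = ⟨⟩-transfer t s t⇒s

  ⊏*ₛ⊆⊏*ₜ : ⊏* Γ s ⊆ᵣ ⊏* Γ t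
  ⊏*ₛ⊆⊏*ₜ = Star-map s⇒t ⊏ₛ⊆⊏ₜ

  ◁ₛ-reversed-in-t : ∀ {δ γ} → ◁ Γ s δ γ → ¬ T (ser (l Γ δ) (l Γ γ)) → pt γ ≤ pt δ →
                     T (inl (l Γ δ) (l Γ γ)) × pt γ < pt δ
  ◁ₛ-reversed-in-t {δ} {γ} δ◁γ@(δ∈ , γ∈ , δ<γ) ¬ser γ≤δ with T? (inl (l Γ δ) (l Γ γ))
  ... | no ¬inl =
    ⊥-elim (⊏ₜ-not-reversed ((s⇒t γ∈ , s⇒t δ∈ , ≢-sym (pos-<⇒≢ s δ<γ) , γ≤δ) ,
                             neither-ser-nor-inl _ _ ¬ser ¬inl) δ◁γ)
  ... | yes inl =
    inl , ≤∧≢⇒< γ≤δ (λ γ≡δ → same-position⇒¬inl t (s⇒t δ∈) (s⇒t γ∈) (pos-<⇒≢ s δ<γ) (sym γ≡δ) inl)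

  -- a (iii)-witness pair δ ◁ₜ γ is ◁ₛ-ordered: directly by (i) if its labels
  -- are not in inl, and otherwise up to the swap allowed for inl-pairs
  ◁ₜ-witness⇒CondIIIₛ : ∀ {α β δ γ} → ◁ Γ t δ γ → ¬ T (ser (l Γ δ) (l Γ γ)) →
                        Between s α β δ γ → CondIII s α β
  ◁ₜ-witness⇒CondIIIₛ {δ = δ} {γ} δ◁γ@(δ∈ , γ∈ , _) ¬ser b with T? (inl (l Γ δ) (l Γ γ))
  ... | no ¬inl = δ , γ , ≺ₜ⊆◁ₛ (δ◁γ , inj₁ (neither-ser-nor-inl _ _ ¬ser ¬inl)) , ¬ser , b
  ... | yes inl with ⟨⟩ₜ-comparable (δ∈ , γ∈ , inl)
  ...   | inj₁ δ◁ₛγ = δ , γ , δ◁ₛγ , ¬ser , b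
  ...   | inj₂ γ◁ₛδ = CondIII-swap s γ◁ₛδ inl b

  ≺ₜ⊆≺ₛ : ≺ Γ t ⊆ᵣ ≺ Γ s
  ≺ₜ⊆≺ₛ p@(_ , inj₁ ¬serinl) = ≺ₜ⊆◁ₛ p , inj₁ ¬serinl
  ≺ₜ⊆≺ₛ p@(_ , inj₂ (inj₁ (α⟨⟩β , c))) =
    ≺ₜ⊆◁ₛ p , inj₂ (inj₁ (⟨⟩ₜ⊆⟨⟩ₛ α⟨⟩β , CondII-transfer t s t⇒s s⇒t ⊏ₜ⊆⊏ₛ c))
  ≺ₜ⊆≺ₛ p@(_ , inj₂ (inj₂ (αβ-ser , δ , γ , δ◁γ , ¬ser , b))) =
    ≺ₜ⊆◁ₛ p , inj₂ (inj₂ (αβ-ser , ◁ₜ-witness⇒CondIIIₛ δ◁γ ¬ser (Between-transfer t s t⇒s ⊏ₜ⊆⊏ₛ b)))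

  -- no ≺ₛ-pair is weakly reversed in t: for (i) it would be a reversed ⊏ₜ-pair,
  -- for (ii) a reversed ≺ₜ-pair, for (iii) its witness pair would be reversed
  -- both strictly and weakly
  ≺ₛ-not-reversed-in-t : ∀ {α β} → ≺ Γ s α β → ¬ pt β ≤ pt α
  ≺ₛ-not-reversed-in-t ((α∈ , β∈ , α<β) , inj₁ ¬serinl) β≤α =
    ⊏ₜ-not-reversed ((s⇒t β∈ , s⇒t α∈ , ≢-sym (pos-<⇒≢ s α<β) , β≤α) , ¬serinl) (α∈ , β∈ , α<β)
  ≺ₛ-not-reversed-in-t {α} {β} ((α∈ , β∈ , α<β) , inj₂ (inj₁ (α⟨⟩β , c))) β≤α =
    <-asym α<β (proj₂ (proj₂ (≺ₜ⊆◁ₛ ((s⇒t β∈ , s⇒t α∈ , β<α) , inj₂ (inj₁ (β⟨⟩α , c⁻¹))))))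
    where
      β<α : pt β < pt α
      β<α = ≤∧≢⇒< β≤α (λ β≡α → same-position⇒¬inl t (s⇒t α∈) (s⇒t β∈) (pos-<⇒≢ s α<β)
                                   (sym β≡α) (proj₂ (proj₂ α⟨⟩β)))
      β⟨⟩α : ⟨⟩ Γ t β α
      β⟨⟩α = ⟨⟩-sym t (⟨⟩ₛ⊆⟨⟩ₜ α⟨⟩β)
      c⁻¹ : CondII t β α
      c⁻¹ = CondII-sym t (CondII-transfer s t s⇒t t⇒s ⊏ₛ⊆⊏ₜ c)
  ≺ₛ-not-reversed-in-t (_ , inj₂ (inj₂ (_ , δ , γ , δ◁γ , ¬ser , αδ , δβ , αγ , γβ))) β≤α =
    <⇒≱ (proj₂ (◁ₛ-reversed-in-t δ◁γ ¬ser γ≤δ)) δ≤γ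
    where
      mono : ∀ {x y} → ⊏* Γ s x y → pt x ≤ pt y
      mono p = pos-mono-⊏* t (⊏*ₛ⊆⊏*ₜ p)
      γ≤δ : pt γ ≤ pt δ
      γ≤δ = ≤-trans (mono γβ) (≤-trans β≤α (mono αδ))
      δ≤γ : pt δ ≤ pt γ
      δ≤γ = ≤-trans (mono δβ) (≤-trans β≤α (mono αγ))

  ≺ₛ⊆◁ₜ : ≺ Γ s ⊆ᵣ ◁ Γ t
  ≺ₛ⊆◁ₜ p@((α∈ , β∈ , _) , _) = s⇒t α∈ , s⇒t β∈ , ≰⇒> (≺ₛ-not-reversed-in-t p)

  ◁ₛ-witness⇒CondIIIₜ : ∀ {α β δ γ} → ◁ Γ s δ γ → ¬ T (ser (l Γ δ) (l Γ γ)) →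
                        Between t α β δ γ → CondIII t α β
  ◁ₛ-witness⇒CondIIIₜ {δ = δ} {γ} δ◁γ@(δ∈ , γ∈ , _) ¬ser b with pt δ <? pt γ
  ... | yes δ<γ = δ , γ , (s⇒t δ∈ , s⇒t γ∈ , δ<γ) , ¬ser , b
  ... | no δ≮γ with ◁ₛ-reversed-in-t δ◁γ ¬ser (≮⇒≥ δ≮γ)
  ...   | inl , γ<δ = CondIII-swap t (s⇒t γ∈ , s⇒t δ∈ , γ<δ) inl b

  ≺ₛ⊆≺ₜ : ≺ Γ s ⊆ᵣ ≺ Γ t
  ≺ₛ⊆≺ₜ p@(_ , inj₁ ¬serinl) = ≺ₛ⊆◁ₜ p , inj₁ ¬serinl
  ≺ₛ⊆≺ₜ p@(_ , inj₂ (inj₁ (α⟨⟩β , c))) =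
    ≺ₛ⊆◁ₜ p , inj₂ (inj₁ (⟨⟩ₛ⊆⟨⟩ₜ α⟨⟩β , CondII-transfer s t s⇒t t⇒s ⊏ₛ⊆⊏ₜ c))
  ≺ₛ⊆≺ₜ p@(_ , inj₂ (inj₂ (αβ-ser , δ , γ , δ◁γ , ¬ser , b))) =
    ≺ₛ⊆◁ₜ p , inj₂ (inj₂ (αβ-ser , ◁ₛ-witness⇒CondIIIₜ δ◁γ ¬ser (Between-transfer s t s⇒t ⊏ₛ⊆⊏ₜ b)))

open Alphabet using (⋈-cong)

lemma11p2 : (Γ : GComtraceAlphabet) (s t : StepSeq Γ) →
    _≈Pred_ Γ (Σₛ Γ s) (Σₛ Γ t) →
    InExt Γ (◁ Γ s) (G Γ t) →
    _≈Str_ Γ (G Γ s) (G Γ t)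
lemma11p2 Γ s t Σₛ≈Σₜ ◁ₛ∈ext =
  ⋈-cong Γ Σₛ≈Σₜ
    (Sum.map ≺ₛ⊆≺ₜ ⟨⟩ₛ⊆⟨⟩ₜ) (Sum.map ≺ₜ⊆≺ₛ ⟨⟩ₜ⊆⟨⟩ₛ)
    (Sum.map ≺ₛ⊆≺ₜ ⊏ₛ⊆⊏ₜ) (Sum.map ≺ₜ⊆≺ₛ ⊏ₜ⊆⊏ₛ)
  where open Extension Γ s t Σₛ≈Σₜ ◁ₛ∈ext
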